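{- In a soft sequence heap with rank threshold $r_0=\lceil\lg\frac1\epsilon\rceil$, for every item $e$ in a sequence of rank $r$, $|C(e)|\le c_r$ and $|W(e)|\le w_r$ where $c_r=w_r=0$ for $r\le r_0$ and $c_r=w_r=2^{\lfloor (r-r_0)/2\rfloor}-1$ for $r>r_0$.
   Context: Soft sequence heap with error parameter $0<\epsilon<1$ and rank threshold $r_0=\lceil\lg\frac1\epsilon\rceil$. The heap is a list of non-empty sequences, each sorted increasingly by real key and having a non-negative integer rank. Each item $e$ in a sequence carries a corruption-set $C(e)$ and a witness-set $W(e)$, initially empty. Operation reduce$(L)$ on $L=e_1,\dots,e_m$: for every $1\le i<m/2$, the item $e_{2i}$ is removed from $L$, $\{e_{2i}\}\cup C(e_{2i})$ is appended to $C(e_{2i+1})$ and $\{e_{2i}\}\cup W(e_{2i})$ is appended to $W(e_{2i-1})$. A new item forms a rank-0 sequence; two sequences of equal rank $r$ are merged by key (items keep their sets) into a sequence of rank $r+1$, and whenever a created sequence has rank $r'>r_0$ with $r'-r_0$ even, reduce is applied to it. Extract-min may remove an item from $C(e)$ of the minimum head item $e$, or remove a head item $e$ from its sequence; no other operation adds items to corruption- or witness-sets. -}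

module Defs where

open import Level using (_⊔_)
open import Data.Nat using (ℕ; zero; suc; _∸_; _^_; _≤ᵇ_; _<ᵇ_; _≡ᵇ_; _/_; _%_)
open import Data.Product using (_×_; _,_; proj₁; proj₂)
open import Relation.Nullary using (does)
open import Relation.Binary.Definitions using (Decidable)
open import Data.Bool using (Bool; true; false; if_then_else_; _∧_)
open import Data.List using (List; []; _∷_; _++_; merge)
open import Data.List.Relation.Unary.All using (All)
open import Data.List.Relation.Binary.Permutation.Propositional using (_↭_)
open import Relation.Binary.Bundles using (DecTotalOrder)
open import Relation.Binary.PropositionalEquality using (_≡_)
open import Relation.Binary.Construct.Closure.ReflexiveTransitive using (Star)

bound : (r₀ r : ℕ) → ℕ
bound r₀ r = if r ≤ᵇ r₀ then 0 else (2 ^ ((r ∸ r₀) / 2)) ∸ 1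

module Heap {a ℓ₁ ℓ₂} (O : DecTotalOrder a ℓ₁ ℓ₂) (r₀ : ℕ) where
  open DecTotalOrder O renaming (Carrier to Key)

  -- an item: its key, its corruption-set C and its witness-set W
  -- (sets of items, represented as lists; |.| is the length)
  data Item : Set a where
    item : Key → List Item → List Item → Item

  key : Item → Key
  key (item k _ _) = k

  C : Item → List Item
  C (item _ c _) = c

  W : Item → List Item
  W (item _ _ w) = w

  addC : Item → Item → Item
  addC b (item k c w) = item k (c ++ (b ∷ C b)) w

  addW : Item → Item → Item
  addW b (item k c w) = item k c (w ++ (b ∷ W b))

  -- reduce on a non-empty list  x ∷ xs = e₁,…,e_m :
  -- for each 1 ≤ i < m/2, e_{2i} is removed, {e_{2i}} ∪ C(e_{2i}) appended to
  -- C(e_{2i+1}) and {e_{2i}} ∪ W(e_{2i}) appended to W(e_{2i-1}).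
  reduce : Item → List Item → Item × List Item
  reduce x (b ∷ c ∷ rest) with reduce (addC b c) rest
  ... | (y , ys) = addW b x , y ∷ ys
  reduce x xs = x , xs

  record Seq : Set a where
    constructor seq
    field
      rank : ℕ
      hd   : Item
      tl   : List Item

  open Seq public

  rankOf : Seq → ℕ
  rankOf (seq r _ _) = r

  items : Seq → List Item
  items s = hd s ∷ tl s

  _≤ᵢ?_ : Decidable (λ (x y : Item) → key x ≤ key y)
  x ≤ᵢ? y = key x ≤? key y

  mergeNE : Item → List Item → Item → List Item → Item × List Item
  mergeNE x xs y ys =
    if does (x ≤ᵢ? y) then (x , merge _≤ᵢ?_ xs (y ∷ ys))
                       else (y , merge _≤ᵢ?_ (x ∷ xs) ys)

  reduceCond : ℕ → Bool
  reduceCond r = (r₀ <ᵇ r) ∧ ((r ∸ r₀) % 2 ≡ᵇ 0)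

  mergeSeq : Seq → Seq → Seq
  mergeSeq (seq r x xs) (seq _ y ys) with mergeNE x xs y ys
  ... | (z , zs) =
    if reduceCond (suc r) then seq (suc r) (proj₁ (reduce z zs)) (proj₂ (reduce z zs))
                          else seq (suc r) z zs

  Heap : Set a
  Heap = List Seq

  -- one operation of the soft sequence heap (the heap is a list of sequences;
  -- its order is immaterial, so reordering is allowed as a step)
  data Step : Heap → Heap → Set (a ⊔ ℓ₂) where
    perm     : ∀ {H H′} → H ↭ H′ → Step H H′
    insert   : ∀ {H} (k : Key) → Step H (seq 0 (item k [] []) [] ∷ H)
    mergeS   : ∀ {H} (s₁ s₂ : Seq) → rank s₁ ≡ rank s₂ →
               Step (s₁ ∷ s₂ ∷ H) (mergeSeq s₁ s₂ ∷ H)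
    -- extract-min: remove an item from C(e) of the minimum head item e
    removeC  : ∀ {H} r k cs c cs′ w es →
               All (λ s → k ≤ key (hd s)) H →
               Step (seq r (item k (cs ++ c ∷ cs′) w) es ∷ H)
                    (seq r (item k (cs ++ cs′) w) es ∷ H)
    -- extract-min: remove a head item from its sequence
    -- (a sequence that becomes empty disappears from the heap)
    removeHd₁ : ∀ {H} r e → Step (seq r e [] ∷ H) H
    removeHd₂ : ∀ {H} r e e′ es → Step (seq r e (e′ ∷ es) ∷ H) (seq r e′ es ∷ H)

  Reachable : Heap → Set (a ⊔ ℓ₂)
  Reachable H = Star Step [] H

-- Every item of a sequence of rank r satisfies |C|, |W| ≤ c_r, and this is preserved by
-- every operation.  Merging two sequences only raises the rank, and c_r is monotone in r.
-- A reduce at rank r + 1 hits only when r − r₀ = 2j + 1, where c_r = 2^j − 1; reduce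
-- appends to each set one removed item and that item's set, so the new sets have size at
-- most 1 + 2 c_r = 2^(j+1) − 1 = c_{r+1}.  Extract-min only shrinks sets or removes items.
module Submission where

open import Defs
open import Data.Nat using (ℕ; _≤_)
open import Data.Product using (_×_)
open import Data.List using (length)
open import Data.List.Membership.Propositional using (_∈_)
open import Relation.Binary.Bundles using (DecTotalOrder)

open import Data.Bool using (true; false)
open import Data.Bool.Properties using (T-≡; T-∧)
open import Data.List using (List; []; _∷_; _++_)
open import Data.List.Properties using (length-++)
open import Data.List.Relation.Unary.All as All using (All; []; _∷_)
open import Data.List.Relation.Unary.All.Properties using (++⁺)
open import Data.List.Relation.Binary.Permutation.Propositional using (_↭_; prep; ↭-trans; ↭-sym)
open import Data.List.Relation.Binary.Permutation.Propositional.Properties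
  using (All-resp-↭; merge-↭; shift)
open import Data.Nat using (suc; _+_; _*_; _∸_; _^_; _≤ᵇ_; _/_; _%_; z≤n; s≤s; s≤s⁻¹; NonZero; >-nonZero)
open import Data.Nat.Properties
open import Data.Nat.DivMod using (+-distrib-/-∣ʳ; m*n/n≡m; /-monoˡ-≤)
open import Data.Nat.Divisibility using (divides; m%n≡0⇒n∣m)
open import Data.Product using (∃; _,_)
open import Function using (Equivalence)
open import Relation.Nullary using (does)
open import Relation.Nullary.Reflects using (ofʸ; ofⁿ)
open import Relation.Binary.Construct.Closure.ReflexiveTransitive using (Star; ε; _◅_)
open import Relation.Binary.PropositionalEquality using (_≡_; refl; sym; trans; cong; module ≡-Reasoning)

open Equivalence using (to; from)

h≤1+h+h : ∀ h → h ≤ suc (h + h)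
h≤1+h+h h = m≤n+m h (suc h)

m≤h⇒n≤h⇒m+1+n≤1+h+h : ∀ {m n h} → m ≤ h → n ≤ h → m + suc n ≤ suc (h + h)
m≤h⇒n≤h⇒m+1+n≤1+h+h {h = h} m≤h n≤h = ≤-trans (+-mono-≤ m≤h (s≤s n≤h)) (≤-reflexive (+-suc h h))

1+[m+n]∸m≡1+n : ∀ m n → suc (m + n) ∸ m ≡ suc n
1+[m+n]∸m≡1+n m n = trans (cong (_∸ m) (sym (+-suc m n))) (m+n∸m≡n m (suc n))

[1+2n]/2≡n : ∀ n → suc (n * 2) / 2 ≡ n
[1+2n]/2≡n n = trans (+-distrib-/-∣ʳ 1 {d = 2} (divides n refl)) (m*n/n≡m n 2)

1+2[n∸1]≡2n∸1 : ∀ n .{{_ : NonZero n}} → suc ((n ∸ 1) + (n ∸ 1)) ≡ 2 * n ∸ 1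
1+2[n∸1]≡2n∸1 (suc m) rewrite +-identityʳ m = sym (+-suc m m)

length-++≤length-++-∷ : ∀ {a} {A : Set a} (xs : List A) y ys → length (xs ++ ys) ≤ length (xs ++ y ∷ ys)
length-++≤length-++-∷ xs y ys = begin
  length (xs ++ ys)            ≡⟨ length-++ xs ⟩
  length xs + length ys        ≤⟨ +-monoʳ-≤ (length xs) (n≤1+n (length ys)) ⟩
  length xs + length (y ∷ ys)  ≡⟨ length-++ xs ⟨
  length (xs ++ y ∷ ys)        ∎
  where open ≤-Reasoning

-- For r ≤ r₀ the truncated difference r ∸ r₀ is 0 and 2 ^ 0 ∸ 1 = 0, so one formula covers both cases.
bound≡ : ∀ r₀ r → bound r₀ r ≡ 2 ^ ((r ∸ r₀) / 2) ∸ 1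
bound≡ r₀ r with r ≤ᵇ r₀ | ≤ᵇ-reflects-≤ r r₀
... | true  | ofʸ r≤r₀ = sym (cong (λ d → 2 ^ (d / 2) ∸ 1) (m≤n⇒m∸n≡0 r≤r₀))
... | false | ofⁿ _    = refl

bound-mono-≤ : ∀ r₀ {r r′} → r ≤ r′ → bound r₀ r ≤ bound r₀ r′
bound-mono-≤ r₀ {r} {r′} r≤r′ rewrite bound≡ r₀ r | bound≡ r₀ r′ =
  ∸-monoˡ-≤ 1 (^-monoʳ-≤ 2 (/-monoˡ-≤ 2 (∸-monoˡ-≤ r₀ r≤r′)))

bound-+ : ∀ r₀ n → bound r₀ (r₀ + n) ≡ 2 ^ (n / 2) ∸ 1
bound-+ r₀ n = trans (bound≡ r₀ (r₀ + n)) (cong (λ d → 2 ^ (d / 2) ∸ 1) (m+n∸m≡n r₀ n))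

bound-reduce : ∀ r₀ j → let r = r₀ + suc (j * 2) in
               suc (bound r₀ r + bound r₀ r) ≡ bound r₀ (suc r)
bound-reduce r₀ j = begin
  suc (bound r₀ r + bound r₀ r)    ≡⟨ cong (λ b → suc (b + b)) bound-r ⟩
  suc ((2 ^ j ∸ 1) + (2 ^ j ∸ 1))  ≡⟨ 1+2[n∸1]≡2n∸1 (2 ^ j) {{>-nonZero (m^n>0 2 j)}} ⟩
  2 ^ suc j ∸ 1                    ≡⟨ cong (λ e → 2 ^ e ∸ 1) (m*n/n≡m (suc j) 2) ⟨
  2 ^ (suc j * 2 / 2) ∸ 1          ≡⟨ bound-+ r₀ (suc j * 2) ⟨
  bound r₀ (r₀ + suc j * 2)        ≡⟨ cong (bound r₀) (+-suc r₀ (suc (j * 2))) ⟩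
  bound r₀ (suc r)                 ∎
  where
  open ≡-Reasoning
  r = r₀ + suc (j * 2)
  bound-r : bound r₀ r ≡ 2 ^ j ∸ 1
  bound-r = trans (bound-+ r₀ (suc (j * 2))) (cong (λ e → 2 ^ e ∸ 1) ([1+2n]/2≡n j))

module _ {a ℓ₁ ℓ₂} (O : DecTotalOrder a ℓ₁ ℓ₂) (r₀ : ℕ) where
  open Heap O r₀

  reduceCond⇒odd-excess : ∀ {r} → reduceCond (suc r) ≡ true → ∃ λ j → r ≡ r₀ + suc (j * 2)
  reduceCond⇒odd-excess {r} cond with to T-∧ (from T-≡ cond)
  ... | r₀<1+r , even with m≤n⇒∃[o]m+o≡n (s≤s⁻¹ (<ᵇ⇒< r₀ (suc r) r₀<1+r))
  ... | e , refl with m%n≡0⇒n∣m (suc e) 2 (trans (cong (_% 2) (sym (1+[m+n]∸m≡1+n r₀ e))) (≡ᵇ⇒≡ _ 0 even))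
  ... | divides (suc j) 1+e≡2[1+j] = j , cong (r₀ +_) (suc-injective 1+e≡2[1+j])

  Bounded : ℕ → Item → Set
  Bounded n e = length (C e) ≤ n × length (W e) ≤ n

  All-Bounded-mono : ∀ {m n} → m ≤ n → ∀ {es} → All (Bounded m) es → All (Bounded n) es
  All-Bounded-mono m≤n = All.map λ (c≤m , w≤m) → ≤-trans c≤m m≤n , ≤-trans w≤m m≤n

  addC-bounded : ∀ {h} b x → length (C b) ≤ h → length (C x) ≤ h → length (C (addC b x)) ≤ suc (h + h)
  addC-bounded b (item _ c _) cb≤h cx≤h =
    ≤-trans (≤-reflexive (length-++ c)) (m≤h⇒n≤h⇒m+1+n≤1+h+h cx≤h cb≤h)

  addW-bounded : ∀ {h} b x → length (W b) ≤ h → length (W x) ≤ h → length (W (addW b x)) ≤ suc (h + h)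
  addW-bounded b (item _ _ w) wb≤h wx≤h =
    ≤-trans (≤-reflexive (length-++ w)) (m≤h⇒n≤h⇒m+1+n≤1+h+h wx≤h wb≤h)

  toList : Item × List Item → List Item
  toList (x , xs) = x ∷ xs

  reduce-bounded : ∀ {h x xs} → All (Bounded h) (x ∷ xs) → All (Bounded (suc (h + h))) (toList (reduce x xs))
  reduce-bounded {h} {x} {xs} ((cx , wx) ∷ bxs) = go x xs (≤-trans cx (h≤1+h+h h)) wx bxs
    where
    -- The current head may already have absorbed a removed item into its C, but not into its W.
    go : ∀ x xs → length (C x) ≤ suc (h + h) → length (W x) ≤ h →
         All (Bounded h) xs → All (Bounded (suc (h + h))) (toList (reduce x xs))
    go x [] cx wx [] = (cx , ≤-trans wx (h≤1+h+h h)) ∷ []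
    go x (b ∷ []) cx wx bb = (cx , ≤-trans wx (h≤1+h+h h)) ∷ All-Bounded-mono (h≤1+h+h h) bb
    go x@(item _ _ _) (b ∷ c@(item _ _ _) ∷ rest) cx wx ((cb , wb) ∷ (cc , wc) ∷ brest) =
      (cx , addW-bounded b x wb wx) ∷ go (addC b c) rest (addC-bounded b c cb cc) wc brest

  mergeNE-↭ : ∀ x xs y ys → toList (mergeNE x xs y ys) ↭ (x ∷ xs) ++ (y ∷ ys)
  mergeNE-↭ x xs y ys with does (x ≤ᵢ? y)
  ... | true  = prep x (merge-↭ _≤ᵢ?_ xs (y ∷ ys))
  ... | false = ↭-trans (prep y (merge-↭ _≤ᵢ?_ (x ∷ xs) ys)) (↭-sym (shift y (x ∷ xs) ys))

  mergeNE-All : ∀ {p} {P : Item → Set p} {x xs y ys} →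
                All P (x ∷ xs) → All P (y ∷ ys) → All P (toList (mergeNE x xs y ys))
  mergeNE-All {x = x} {xs} {y} {ys} px py = All-resp-↭ (↭-sym (mergeNE-↭ x xs y ys)) (++⁺ px py)

  SeqBounded : Seq → Set a
  SeqBounded s = All (Bounded (bound r₀ (rankOf s))) (items s)

  HeapBounded : Heap → Set a
  HeapBounded = All SeqBounded

  mergeSeq-bounded : ∀ s₁ s₂ → rank s₁ ≡ rank s₂ → SeqBounded s₁ → SeqBounded s₂ →
                     SeqBounded (mergeSeq s₁ s₂)
  mergeSeq-bounded (seq r x xs) (seq .r y ys) refl b₁ b₂ with reduceCond (suc r) in cond
  ... | true with reduceCond⇒odd-excess cond
  ...   | j , refl =
    All-Bounded-mono (≤-reflexive (bound-reduce r₀ j)) (reduce-bounded (mergeNE-All b₁ b₂))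
  mergeSeq-bounded (seq r x xs) (seq .r y ys) refl b₁ b₂ | false =
    All-Bounded-mono (bound-mono-≤ r₀ (n≤1+n r)) (mergeNE-All b₁ b₂)

  step-bounded : ∀ {H H′} → Step H H′ → HeapBounded H → HeapBounded H′
  step-bounded (perm H↭H′)                   bH                         = All-resp-↭ H↭H′ bH
  step-bounded (insert k)                    bH                         = ((z≤n , z≤n) ∷ []) ∷ bH
  step-bounded (mergeS s₁ s₂ r₁≡r₂)          (b₁ ∷ b₂ ∷ bH)             = mergeSeq-bounded s₁ s₂ r₁≡r₂ b₁ b₂ ∷ bH
  step-bounded (removeC r k cs c cs′ w es _) (((ce , we) ∷ bes) ∷ bH) =
    ((≤-trans (length-++≤length-++-∷ cs c cs′) ce , we) ∷ bes) ∷ bH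
  step-bounded (removeHd₁ r e)               (_ ∷ bH)                   = bH
  step-bounded (removeHd₂ r e e′ es)         ((_ ∷ bes) ∷ bH)           = bes ∷ bH

  reachable-bounded : ∀ {H} → Reachable H → HeapBounded H
  reachable-bounded = go []
    where
    go : ∀ {H H′} → HeapBounded H → Star Step H H′ → HeapBounded H′
    go bH ε           = bH
    go bH (s ◅ steps) = go (step-bounded s bH) steps

lemma6 : ∀ {a ℓ₁ ℓ₂} (O : DecTotalOrder a ℓ₁ ℓ₂) (r₀ : ℕ) → 1 ≤ r₀ →
           ∀ (H : Heap.Heap O r₀) → Heap.Reachable O r₀ H →
           ∀ s → s ∈ H → ∀ e → e ∈ Heap.items O r₀ s →
           (length (Heap.C O r₀ e) ≤ bound r₀ (Heap.rankOf O r₀ s))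
           × (length (Heap.W O r₀ e) ≤ bound r₀ (Heap.rankOf O r₀ s))
lemma6 O r₀ _ H reachable s s∈H e e∈s =
  All.lookup (All.lookup (reachable-bounded O r₀ reachable) s∈H) e∈s
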